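{- For every execution graph $G$, thread $T$ and iteration index $q$ with $\mathit{fail}_G^T(q)$, writing $n=\mathit{len}_G^T(q)$: $k_G^T(\mathit{end}_G^T(q)+1)=k_G^T(\mathit{start}_G^T(q))$, $\mathit{start}_G^T(q+1)=\mathit{end}_G^T(q)+1$, and $\mathit{end}_G^T(q+1)=\mathit{end}_G^T(q)+1+n$.
   Context: Fix finite sets $\mathit{Register}$, $\mathit{Location}$, $\mathit{Value}$ and a finite set of threads $\mathcal T$. A state is a function $\sigma:\mathit{Register}\to\mathit{Value}$; an update is a partial function $\mu:\mathit{Register}\rightharpoonup\mathit{Value}$, and $(\sigma\ll\mu)(r)=\mu(r)$ if $r\in\mathrm{Dom}(\mu)$, else $\sigma(r)$. Events are $R^m(x)$, $W^m(x,v)$, $F^m$, and the error event $E$, with $m\in\{\mathrm{rlx},\mathrm{rel},\mathrm{acq},\mathrm{sc}\}$. A program $P$ gives each $T\in\mathcal T$ a finite sequence $P_T(0),\dots,P_T(|P_T|-1)$ of statements, each either $\mathtt{step}(\epsilon,\delta)$ with $\epsilon:\mathit{State}\to\mathit{Event}$, $\delta:\mathit{State}\times(\mathit{Value}\cup\{\bot\})\to\mathit{Update}$, or $\mathtt{await}(n,\kappa)$ with $n\in\mathbb N$, $\kappa:\mathit{State}\to\{0,1\}$; whenever $P_T(k)=\mathtt{await}(n,\kappa)$ we have $n\le k$ and no $P_T(k')$ with $k'\in[k-n,k)$ is an await. An execution graph $G$ consists of a set $G.\mathrm{E}$ of triples $\langle T,t,e\rangle$ (thread, index, event), a reads-from relation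 $G.\mathrm{rf}$ (each read has at most one incoming edge from a write; $G.\mathrm{rf}(r)$ is that write or $\bot$), and a modification order; $w.\mathrm{val}$ is the value of write $w$. Thread-local semantics relative to $G$: $k_G^T(0)=0$, $\sigma_G^T(0)$ a fixed initial state. If $k_G^T(t)\ge|P_T|$ or no triple $\langle T,t,\cdot\rangle$ is in $G.\mathrm{E}$, then the number of steps is $N_G^T=t$. Otherwise step $t$ executes $S=P_T(k_G^T(t))$. If $S=\mathtt{await}(n,\kappa)$: $e_G^T(t)=F^{\mathrm{rlx}}$, $\sigma_G^T(t+1)=\sigma_G^T(t)$, and $k_G^T(t+1)=k_G^T(t)+1$ if $\kappa(\sigma_G^T(t))=0$, else $k_G^T(t)-n$. If $S=\mathtt{step}(\epsilon,\delta)$: $e_G^T(t)=\epsilon(\sigma_G^T(t))$, $k_G^T(t+1)=k_G^T(t)+1$; $v_G^T(t)$ is the value of the write $G.\mathrm{rf}(\langle T,t,e_G^T(t)\rangle)$ if $e_G^T(t)$ is a read with an incoming rf-edge, else $\bot$; if $e_G^T(t)$ is not a read or $v_G^T(t)\neq\bot$ then $\sigma_G^T(t+1)=\sigma_G^T(t)\ll\delta(\sigma_G^T(t),v_G^T(t))$, otherwise $\sigma_G^T(t+1)=\sigma_G^T(t)$ and $N_G^T=t+1$. Await iterations: $\mathit{end}_G^T(0)<\mathit{end}_G^T(1)<\cdots$ enumerate the steps $t$ at which $P_T(k_G^T(t))$ is an await; $\mathit{len}_G^T(q)=n$ where $P_T(k_G^T(\mathit{end}_G^T(q)))=\mathtt{await}(n,\kappa)$;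 $\mathit{start}_G^T(q)=\mathit{end}_G^T(q)-\mathit{len}_G^T(q)$; iteration $q$ fails, $\mathit{fail}_G^T(q)$, iff $\kappa(\sigma_G^T(\mathit{end}_G^T(q)))=1$. -}

module Defs where

open import Data.Nat using (ℕ; zero; suc; _∸_; _≤_; _<_)
open import Data.Fin using (Fin)
open import Data.Bool using (Bool; true; false; if_then_else_)
open import Data.Maybe using (Maybe; just; nothing)
open import Data.List using (List; []; _∷_)
open import Data.Product using (_×_; _,_; Σ; ∃)
open import Relation.Binary.PropositionalEquality using (_≡_)
open import Relation.Nullary using (¬_)

data Mode : Set where
  rlx rel acq sc : Mode

at : ∀ {A : Set} → List A → ℕ → Maybe A
at []       _       = nothing
at (x ∷ xs) zero    = just x
at (x ∷ xs) (suc k) = at xs k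

module Semantics (nReg nLoc nVal nThr : ℕ) where

  Register Location Value Thread : Set
  Register = Fin nReg
  Location = Fin nLoc
  Value    = Fin nVal
  Thread   = Fin nThr

  State : Set
  State = Register → Value

  Update : Set
  Update = Register → Maybe Value

  _≪_ : State → Update → State
  (σ ≪ μ) r with μ r
  ... | just v  = v
  ... | nothing = σ r

  data Event : Set where
    R : Mode → Location → Event
    W : Mode → Location → Value → Event
    F : Mode → Event
    E : Event

  isRead : Event → Bool
  isRead (R _ _) = true
  isRead _       = false

  isWrite : Event → Bool
  isWrite (W _ _ _) = true
  isWrite _         = false

  loc : Event → Maybe Location
  loc (R _ x)   = just x
  loc (W _ x _) = just x
  loc _         = nothing

  wval : Event → Maybe Value
  wval (W _ _ v) = just v
  wval _         = nothing

  -- Statements: step(ε, δ) and await(n, κ); the value argument of δ is Value ∪ {⊥} = Maybe Value.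
  data Stmt : Set where
    step  : (State → Event) → (State → Maybe Value → Update) → Stmt
    await : ℕ → (State → Bool) → Stmt

  Program : Set
  Program = Thread → List Stmt

  awaitStep? : Maybe Stmt → Bool
  awaitStep? (just (await _ _)) = true
  awaitStep? _                  = false

  IsAwait : Maybe Stmt → Set
  IsAwait s = awaitStep? s ≡ true

  WellFormed : Program → Set
  WellFormed P = ∀ T k n κ → at (P T) k ≡ just (await n κ) →
    (n ≤ k) × (∀ k' → k ∸ n ≤ k' → k' < k → ¬ IsAwait (at (P T) k'))

  Triple : Set
  Triple = Thread × ℕ × Event

  tevent : Triple → Event
  tevent (_ , _ , e) = e

  -- Execution graph: events, reads-from (each read has at most one incoming rf edge,
  -- given as a partial function from reads to writes), modification order.
  record ExecGraph : Set₁ where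
    field
      Ev : Triple → Set
      rf : Triple → Maybe Triple
      mo : Triple → Triple → Set
      rf-dom   : ∀ r w → rf r ≡ just w → Ev r × Ev w
      rf-read  : ∀ r w → rf r ≡ just w → isRead (tevent r) ≡ true
      rf-write : ∀ r w → rf r ≡ just w → isWrite (tevent w) ≡ true
      rf-loc   : ∀ r w → rf r ≡ just w → loc (tevent r) ≡ loc (tevent w)
  open ExecGraph public

  -- v_G^T(t) for the triple ⟨T,t,e⟩: value of the rf-source write, or ⊥ (= nothing)
  rfVal : ExecGraph → Triple → Maybe Value
  rfVal G r with rf G r
  ... | just w  = wval (tevent w)
  ... | nothing = nothing

  -- One step of the thread-local semantics, from configuration (k_G^T(t), σ_G^T(t)).
  -- Convention once k ≥ |P_T| (no statement): the configuration is frozen.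
  stepConf : ExecGraph → Program → Thread → ℕ → ℕ × State → ℕ × State
  stepConf G P T t (k , σ) with at (P T) k
  ... | nothing = (k , σ)
  ... | just (await n κ) = ((if κ σ then k ∸ n else suc k) , σ)
  ... | just (step ε δ) with isRead (ε σ) | rfVal G (T , t , ε σ)
  ...   | false | _       = (suc k , (σ ≪ δ σ nothing))
  ...   | true  | just v  = (suc k , (σ ≪ δ σ (just v)))
  ...   | true  | nothing = (suc k , σ)

  conf : State → ExecGraph → Program → Thread → ℕ → ℕ × State
  conf σ₀ G P T zero    = (0 , σ₀)
  conf σ₀ G P T (suc t) = stepConf G P T t (conf σ₀ G P T t)

  kk : State → ExecGraph → Program → Thread → ℕ → ℕ
  kk σ₀ G P T t = Data.Product.proj₁ (conf σ₀ G P T t)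
    where import Data.Product

  σσ : State → ExecGraph → Program → Thread → ℕ → State
  σσ σ₀ G P T t = Data.Product.proj₂ (conf σ₀ G P T t)
    where import Data.Product

  stmtAt : State → ExecGraph → Program → Thread → ℕ → Maybe Stmt
  stmtAt σ₀ G P T t = at (P T) (kk σ₀ G P T t)

  countAwait : State → ExecGraph → Program → Thread → ℕ → ℕ
  countAwait σ₀ G P T zero    = 0
  countAwait σ₀ G P T (suc t) =
    (if awaitStep? (stmtAt σ₀ G P T t) then suc else (λ m → m)) (countAwait σ₀ G P T t)

  IsEnd : State → ExecGraph → Program → Thread → ℕ → ℕ → Set
  IsEnd σ₀ G P T q t =
    (awaitStep? (stmtAt σ₀ G P T t) ≡ true) × (countAwait σ₀ G P T t ≡ q)

  lenAt : State → ExecGraph → Program → Thread → ℕ → ℕ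
  lenAt σ₀ G P T t with stmtAt σ₀ G P T t
  ... | just (await n _) = n
  ... | _                = 0

-- A failed await at program counter k jumps back to k ∸ n. By well-formedness the window
-- [k ∸ n, k) contains only step statements, and no await elsewhere in the program can jump
-- into (k ∸ n, k]; hence the window is always entered at k ∸ n and executed straight through.
-- Read forwards, this brings the thread back to k after n more steps with no await in between;
-- read backwards, the n steps before the await ran through the window from k ∸ n as well.
module Submission where

open import Defs
open import Data.Nat using (ℕ; zero; suc; _+_; _∸_; _≤_; _<_; s≤s)
open import Data.Nat.Properties
open import Data.Bool using (Bool; true; false; if_then_else_)
open import Data.Maybe using (Maybe; just; nothing)
open import Data.List using (List; []; _∷_)
open import Data.Product using (_×_; _,_; proj₁; proj₂)
open import Data.Empty using (⊥; ⊥-elim)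
open import Relation.Binary.Definitions using (tri<; tri≈; tri>)
open import Relation.Binary.PropositionalEquality

at-nothing-mono : ∀ {A : Set} (xs : List A) {k k'} → at xs k ≡ nothing → k ≤ k' → at xs k' ≡ nothing
at-nothing-mono []       _         _ = refl
at-nothing-mono (x ∷ xs) {zero}    () _
at-nothing-mono (x ∷ xs) {suc k} {suc k'} e (s≤s k≤k') = at-nothing-mono xs e k≤k'

m∸n+o<m : ∀ {m n o} → n ≤ m → o < n → m ∸ n + o < m
m∸n+o<m {m} {n} {o} n≤m o<n = subst (m ∸ n + o <_) (m∸n+n≡m n≤m) (+-monoʳ-< (m ∸ n) o<n)

module ThreadSemantics (nReg nLoc nVal nThr : ℕ) where
  open Semantics nReg nLoc nVal nThr

  nextPc : Maybe Stmt → ℕ → State → ℕ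
  nextPc nothing            k σ = k
  nextPc (just (step _ _))  k σ = suc k
  nextPc (just (await n κ)) k σ = if κ σ then k ∸ n else suc k

  nextPc≤suc : ∀ st k σ → nextPc st k σ ≤ suc k
  nextPc≤suc nothing            k σ = n≤1+n k
  nextPc≤suc (just (step _ _))  k σ = ≤-refl
  nextPc≤suc (just (await n κ)) k σ with κ σ
  ... | true  = ≤-trans (m∸n≤m k n) (n≤1+n k)
  ... | false = ≤-refl

  data IsStep : Maybe Stmt → Set where
    is-step : ∀ ε δ → IsStep (just (step ε δ))

  IsStep⇒nextPc≡suc : ∀ {st} → IsStep st → ∀ k σ → nextPc st k σ ≡ suc k
  IsStep⇒nextPc≡suc (is-step _ _) k σ = refl

  IsStep⇒¬await : ∀ {st} → IsStep st → awaitStep? st ≡ false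
  IsStep⇒¬await (is-step _ _) = refl

  module WellFormedProgram (P : Program) (wf : WellFormed P) (T : Thread) where

    window<pc : ∀ {k n κ j} → at (P T) k ≡ just (await n κ) → j < n → k ∸ n + j < k
    window<pc {k} {n} {κ} hk = m∸n+o<m (proj₁ (wf T k n κ hk))

    window-IsStep : ∀ {k n κ j} → at (P T) k ≡ just (await n κ) → j < n →
                    IsStep (at (P T) (k ∸ n + j))
    window-IsStep {k} {n} {κ} {j} hk j<n with at (P T) (k ∸ n + j) in eq
    ... | just (step ε δ) = is-step ε δ
    ... | just (await _ _) =
      ⊥-elim (proj₂ (wf T k n κ hk) (k ∸ n + j) (m≤m+n (k ∸ n) j)
                     (window<pc hk j<n) (cong awaitStep? eq))
    ... | nothing
      with () ← trans (sym hk)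
                      (at-nothing-mono (P T) eq (<⇒≤ (window<pc hk j<n)))

    -- An await at k' whose target k' ∸ n' fell into (k ∸ n, k] would either have k inside its
    -- own window (k < k') or lie inside the window of k (k' < k).
    jump-outside-window : ∀ {k n κ k' n' κ'} →
      at (P T) k ≡ just (await n κ) → at (P T) k' ≡ just (await n' κ') →
      k ∸ n < k' ∸ n' → k' ∸ n' ≤ k → ⊥
    jump-outside-window {k} {n} {κ} {k'} {n'} {κ'} hk hk' below above with <-cmp k k'
    ... | tri< k<k' _ _ = proj₂ (wf T k' n' κ' hk') k above k<k' (cong awaitStep? hk)
    ... | tri> _ _ k'<k =
      proj₂ (wf T k n κ hk) k' (<⇒≤ (<-≤-trans below (m∸n≤m k' n'))) k'<k (cong awaitStep? hk')
    ... | tri≈ _ refl _ with refl ← trans (sym hk) hk' = <-irrefl refl below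

    nextPc-into-window : ∀ {k n κ j} k₀ σ → at (P T) k ≡ just (await n κ) → j < n →
      nextPc (at (P T) k₀) k₀ σ ≡ suc (k ∸ n + j) → k₀ ≡ k ∸ n + j
    nextPc-into-window {k} {n} {κ} {j} k₀ σ hk j<n e with at (P T) k₀ in eq
    ... | just (step _ _) = suc-injective e
    ... | nothing
      with () ← trans (sym hk) (at-nothing-mono (P T) eq
                  (subst (_≤ k) (sym e) (window<pc hk j<n)))
    ... | just (await n' κ') with κ' σ
    ...   | false with () ←
      trans (sym (IsStep⇒¬await (window-IsStep hk j<n)))
            (cong awaitStep? (trans (cong (at (P T)) (sym (suc-injective e))) eq))
    ...   | true = ⊥-elim (jump-outside-window hk eq
                    (subst (k ∸ n <_) (sym e) (s≤s (m≤m+n (k ∸ n) j)))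
                    (subst (_≤ k) (sym e) (window<pc hk j<n)))

  module Run (σ₀ : State) (G : ExecGraph) (P : Program) (T : Thread) where

    pc : ℕ → ℕ
    pc = kk σ₀ G P T

    stepConf-pc : ∀ s k σ → proj₁ (stepConf G P T s (k , σ)) ≡ nextPc (at (P T) k) k σ
    stepConf-pc s k σ with at (P T) k
    ... | nothing          = refl
    ... | just (await _ _) = refl
    ... | just (step ε δ) with isRead (ε σ) | rfVal G (T , s , ε σ)
    ...   | false | _       = refl
    ...   | true  | just _  = refl
    ...   | true  | nothing = refl

    pc-suc : ∀ s → pc (suc s) ≡ nextPc (stmtAt σ₀ G P T s) (pc s) (σσ σ₀ G P T s)
    pc-suc s = stepConf-pc s (pc s) (σσ σ₀ G P T s)

    pc≤step : ∀ s → pc s ≤ s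
    pc≤step zero    = ≤-refl
    pc≤step (suc s) = begin
      pc (suc s)                                             ≡⟨ pc-suc s ⟩
      nextPc (stmtAt σ₀ G P T s) (pc s) (σσ σ₀ G P T s)      ≤⟨ nextPc≤suc (stmtAt σ₀ G P T s) (pc s) _ ⟩
      suc (pc s)                                             ≤⟨ s≤s (pc≤step s) ⟩
      suc s                                                  ∎
      where open ≤-Reasoning

    pc-after-failed-await : ∀ s {n κ} → stmtAt σ₀ G P T s ≡ just (await n κ) →
                            κ (σσ σ₀ G P T s) ≡ true → pc (suc s) ≡ pc s ∸ n
    pc-after-failed-await s st κ-true rewrite pc-suc s | st | κ-true = refl

    countAwait-after-await : ∀ s → awaitStep? (stmtAt σ₀ G P T s) ≡ true →
                             countAwait σ₀ G P T (suc s) ≡ suc (countAwait σ₀ G P T s)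
    countAwait-after-await s isAwait rewrite isAwait = refl

    countAwait-after-step : ∀ s → IsStep (stmtAt σ₀ G P T s) →
                            countAwait σ₀ G P T (suc s) ≡ countAwait σ₀ G P T s
    countAwait-after-step s isStep rewrite IsStep⇒¬await isStep = refl

    lenAt-await : ∀ s {n κ} → stmtAt σ₀ G P T s ≡ just (await n κ) → lenAt σ₀ G P T s ≡ n
    lenAt-await s st rewrite st = refl

    run-steps : ∀ {p} i s → (∀ j → j < i → IsStep (at (P T) (p + j))) → pc s ≡ p →
                pc (s + i) ≡ p + i × countAwait σ₀ G P T (s + i) ≡ countAwait σ₀ G P T s
    run-steps {p} zero s _ pc≡ rewrite +-identityʳ s | +-identityʳ p = pc≡ , refl
    run-steps {p} (suc i) s steps pc≡
      with pc≡′ , count≡ ← run-steps i s (λ j j<i → steps j (m<n⇒m<1+n j<i)) pc≡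
      rewrite +-suc s i =
        (begin
           pc (suc (s + i))          ≡⟨ pc-suc (s + i) ⟩
           nextPc (stmtAt σ₀ G P T (s + i)) (pc (s + i)) (σσ σ₀ G P T (s + i))
                                     ≡⟨ IsStep⇒nextPc≡suc isStep (pc (s + i)) (σσ σ₀ G P T (s + i)) ⟩
           suc (pc (s + i))          ≡⟨ cong suc pc≡′ ⟩
           suc (p + i)               ≡⟨ +-suc p i ⟨
           p + suc i                 ∎)
      , trans (countAwait-after-step (s + i) isStep) count≡
      where
      open ≡-Reasoning
      isStep : IsStep (stmtAt σ₀ G P T (s + i))
      isStep = subst (λ k → IsStep (at (P T) k)) (sym pc≡′) (steps i ≤-refl)

    pc-back : WellFormed P → ∀ {k n κ} → at (P T) k ≡ just (await n κ) →
              ∀ j s → j ≤ n → pc (j + s) ≡ k ∸ n + j → pc s ≡ k ∸ n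
    pc-back wf {k} {n} _ zero s _ pc≡ = trans pc≡ (+-identityʳ (k ∸ n))
    pc-back wf {k} {n} hk (suc j) s j<n pc≡ =
      pc-back wf hk j s (<⇒≤ j<n)
        (nextPc-into-window (pc (j + s)) (σσ σ₀ G P T (j + s)) hk j<n
          (trans (sym (pc-suc (j + s))) (trans pc≡ (+-suc (k ∸ n) j))))
      where open WellFormedProgram P wf T

lemma4 : (nReg nLoc nVal nThr : ℕ) →
    let open Semantics nReg nLoc nVal nThr in
    (σ₀ : State) (P : Program) → WellFormed P →
    (G : ExecGraph) (T : Thread) (q t : ℕ) →
    IsEnd σ₀ G P T q t →
    (n : ℕ) (κ : State → Bool) →
    stmtAt σ₀ G P T t ≡ just (await n κ) →
    κ (σσ σ₀ G P T t) ≡ true →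
    (kk σ₀ G P T (suc t) ≡ kk σ₀ G P T (t ∸ n))
    × (((suc t + n) ∸ lenAt σ₀ G P T (suc t + n) ≡ suc t)
    × IsEnd σ₀ G P T (suc q) (suc t + n))
lemma4 nReg nLoc nVal nThr σ₀ P wf G T q t (isAwait , count≡q) n κ st κ-true =
  trans jump (sym before) , len-back , cong awaitStep? st-after , count-after
  where
  open Semantics nReg nLoc nVal nThr
  open ThreadSemantics nReg nLoc nVal nThr
  open Run σ₀ G P T
  open WellFormedProgram P wf T

  n≤pc : n ≤ pc t
  n≤pc = proj₁ (wf T (pc t) n κ st)

  jump : pc (suc t) ≡ pc t ∸ n
  jump = pc-after-failed-await t st κ-true

  before : pc (t ∸ n) ≡ pc t ∸ n
  before = pc-back wf st n (t ∸ n) ≤-refl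
    (trans (cong pc (m+[n∸m]≡n (≤-trans n≤pc (pc≤step t)))) (sym (m∸n+n≡m n≤pc)))

  after : pc (suc t + n) ≡ pc t ∸ n + n × countAwait σ₀ G P T (suc t + n) ≡ countAwait σ₀ G P T (suc t)
  after = run-steps n (suc t) (λ _ → window-IsStep st) jump

  st-after : stmtAt σ₀ G P T (suc t + n) ≡ just (await n κ)
  st-after = trans (cong (at (P T)) (trans (proj₁ after) (m∸n+n≡m n≤pc))) st

  len-back : suc t + n ∸ lenAt σ₀ G P T (suc t + n) ≡ suc t
  len-back = trans (cong (suc t + n ∸_) (lenAt-await (suc t + n) st-after)) (m+n∸n≡m (suc t) n)

  count-after : countAwait σ₀ G P T (suc t + n) ≡ suc q
  count-after = trans (proj₂ after) (trans (countAwait-after-await t isAwait) (cong suc count≡q))
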